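{- Let $G$ be a finite group admitting a colouring bijection $\sigma\colon G\to G$. Then the function $c\colon G^3\to G$, $c(x,y,z)=x^{ -1}\sigma(y)z$, is a proper vertex colouring of the graph $\mathscr{G}_3(G)$ with $|G|$ colours (i.e. adjacent vertices receive distinct values of $c$).
   Context: For a map $\sigma\colon G\to G$ define $\Delta^{(1)}_\sigma(x)=\sigma(x)x$, $\Delta^{(2)}_\sigma(x)=x^{ -1}\sigma(x)$, $\Delta^{(3)}_\sigma(x)=x^{ -1}\sigma(x)x$. A bijection $\sigma$ is a colouring bijection if all three maps $\Delta^{(i)}_\sigma$ are bijections of $G$. The graph $\mathscr{G}_3(G)$ is the Cayley graph $\mathrm{Cay}(G^3,\mathbf S_3)$ with vertex set $G^3$, where $\mathbf S_3=\{(g,e,e),(e,g,e),(e,e,g),(g,g,e),(e,g,g),(g,g,g)\mid g\in G\setminus\{e\}\}$ and $v$ is adjacent to $sv$ for $s\in\mathbf S_3$ (componentwise left multiplication). -}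

module Defs where

open import Level using (0ℓ)
open import Algebra.Bundles using (Group)
open import Data.Fin using (Fin)
open import Data.Nat using (ℕ)
open import Data.Product using (_×_; _,_; Σ)
open import Function.Bundles using (Func; Bijection)
open import Function.Definitions using (Bijective)
open import Relation.Binary.PropositionalEquality as ≡ using ()
open import Relation.Nullary using (¬_)

module _ (G : Group 0ℓ 0ℓ) where
  open Group G

  IsFinite : Set
  IsFinite = Σ ℕ λ n → Bijection (≡.setoid (Fin n)) setoid

  Map : Set
  Map = Func setoid setoid

  Δ₁ Δ₂ Δ₃ : Map → Carrier → Carrier
  Δ₁ σ x = Func.to σ x ∙ x
  Δ₂ σ x = x ⁻¹ ∙ Func.to σ x
  Δ₃ σ x = (x ⁻¹ ∙ Func.to σ x) ∙ x

  IsBijective : (Carrier → Carrier) → Set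
  IsBijective f = (∀ {x y} → x ≈ y → f x ≈ f y) × Bijective _≈_ _≈_ f

  IsColouringBijection : Map → Set
  IsColouringBijection σ =
    IsBijective (Func.to σ) × IsBijective (Δ₁ σ) × IsBijective (Δ₂ σ) × IsBijective (Δ₃ σ)

  G³ : Set
  G³ = Carrier × Carrier × Carrier

  data S₃ : G³ → Set where
    s100 : ∀ g → ¬ g ≈ ε → S₃ (g , ε , ε)
    s010 : ∀ g → ¬ g ≈ ε → S₃ (ε , g , ε)
    s001 : ∀ g → ¬ g ≈ ε → S₃ (ε , ε , g)
    s110 : ∀ g → ¬ g ≈ ε → S₃ (g , g , ε)
    s011 : ∀ g → ¬ g ≈ ε → S₃ (ε , g , g)
    s111 : ∀ g → ¬ g ≈ ε → S₃ (g , g , g)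

  _·_ : G³ → G³ → G³
  (a , b , c) · (x , y , z) = (a ∙ x , b ∙ y , c ∙ z)

  -- Adjacency in 𝒢₃(G) = Cay(G³, S₃): v ~ w iff w = s v for some s ∈ S₃
  -- (equality taken up to the group's ≈).
  _≈³_ : G³ → G³ → Set
  (a , b , c) ≈³ (x , y , z) = (a ≈ x) × (b ≈ y) × (c ≈ z)

  Adjacent : G³ → G³ → Set
  Adjacent v w = Σ G³ λ s → S₃ s × (w ≈³ (s · v))

  colour : Map → G³ → Carrier
  colour σ (x , y , z) = (x ⁻¹ ∙ Func.to σ y) ∙ z

  IsProperColouring : (G³ → Carrier) → Set
  IsProperColouring c = ∀ v w → Adjacent v w → ¬ c v ≈ c w

{-# OPTIONS --safe #-}
-- Writing q(a, b) = a⁻¹ b, the colour factors as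
--   c(x, y, z) = x⁻¹ σ(y) z = q(x, y) Δ⁽²⁾(y) z = x⁻¹ Δ⁽¹⁾(y) q(y, z) = q(x, y) Δ⁽³⁾(y) q(y, z),
-- and q is invariant under simultaneous left translation.  So if a generator with non-trivial
-- entry g preserves the colour of (x, y, z), cancelling the unchanged factors leaves
-- f(g u) = f(u) for u = x or y or z and f one of x ↦ x⁻¹, id, σ, Δ⁽¹⁾, Δ⁽²⁾, Δ⁽³⁾.  Each such f
-- is injective, so g u = u and g = e.
module Submission where

open import Defs
open import Level using (0ℓ)
open import Algebra.Bundles using (Group)
open import Data.Product using (_,_)
open import Function.Bundles using (Func)
open import Function.Definitions using (Injective)
open import Relation.Nullary using (¬_)
import Algebra.Properties.Group as GroupProperties
import Relation.Binary.Reasoning.Setoid as SetoidReasoning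

module _ {c ℓ} (G : Group c ℓ) where
  open Group G
  open GroupProperties G

  ⁻¹∙-invariant : ∀ g x y → (g ∙ x) ⁻¹ ∙ (g ∙ y) ≈ x ⁻¹ ∙ y
  ⁻¹∙-invariant g x y = begin
    (g ∙ x) ⁻¹ ∙ (g ∙ y)      ≈⟨ ∙-congʳ (⁻¹-anti-homo-∙ g x) ⟩
    (x ⁻¹ ∙ g ⁻¹) ∙ (g ∙ y)   ≈⟨ assoc (x ⁻¹) (g ⁻¹) (g ∙ y) ⟩
    x ⁻¹ ∙ (g ⁻¹ ∙ (g ∙ y))   ≈⟨ ∙-congˡ (\\-leftDividesʳ g y) ⟩
    x ⁻¹ ∙ y                  ∎
    where open SetoidReasoning setoid

  ∙-insert : ∀ a y b → (a ∙ y) ∙ (y ⁻¹ ∙ b) ≈ a ∙ b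
  ∙-insert a y b = trans (assoc a y (y ⁻¹ ∙ b)) (∙-congˡ (\\-leftDividesˡ y b))

  ∙-cancel-frame : ∀ a c {b d} → (a ∙ b) ∙ c ≈ (a ∙ d) ∙ c → b ≈ d
  ∙-cancel-frame a c {b} {d} eq = ∙-cancelˡ a b d (∙-cancelʳ c (a ∙ b) (a ∙ d) eq)

  f[g∙u]≈f[u]⇒g≈ε : ∀ {f} → Injective _≈_ _≈_ f → ∀ g u → f (g ∙ u) ≈ f u → g ≈ ε
  f[g∙u]≈f[u]⇒g≈ε f-injective g u eq = identityˡ-unique g u (f-injective eq)

module _ (G : Group 0ℓ 0ℓ) (σ : Map G) where
  open Group G
  open GroupProperties G
  open SetoidReasoning setoid

  private
    σ₀ = Func.to σ
    col = colour G σ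

  colour-cong : ∀ {v w} → _≈³_ G v w → col v ≈ col w
  colour-cong (x≈x′ , y≈y′ , z≈z′) = ∙-cong (∙-cong (⁻¹-cong x≈x′) (Func.cong σ y≈y′)) z≈z′

  colour-via-Δ₁ : ∀ x y z → col (x , y , z) ≈ (x ⁻¹ ∙ Δ₁ G σ y) ∙ (y ⁻¹ ∙ z)
  colour-via-Δ₁ x y z = begin
    (x ⁻¹ ∙ σ₀ y) ∙ z                    ≈⟨ assoc (x ⁻¹) (σ₀ y) z ⟩
    x ⁻¹ ∙ (σ₀ y ∙ z)                    ≈⟨ ∙-congˡ (∙-insert G (σ₀ y) y z) ⟨
    x ⁻¹ ∙ ((σ₀ y ∙ y) ∙ (y ⁻¹ ∙ z))     ≈⟨ assoc (x ⁻¹) (σ₀ y ∙ y) (y ⁻¹ ∙ z) ⟨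
    (x ⁻¹ ∙ (σ₀ y ∙ y)) ∙ (y ⁻¹ ∙ z)     ∎

  colour-via-Δ₂ : ∀ x y z → col (x , y , z) ≈ ((x ⁻¹ ∙ y) ∙ Δ₂ G σ y) ∙ z
  colour-via-Δ₂ x y z = ∙-congʳ (sym (∙-insert G (x ⁻¹) y (σ₀ y)))

  colour-via-Δ₃ : ∀ x y z → col (x , y , z) ≈ ((x ⁻¹ ∙ y) ∙ Δ₃ G σ y) ∙ (y ⁻¹ ∙ z)
  colour-via-Δ₃ x y z = begin
    col (x , y , z)                                ≈⟨ colour-via-Δ₂ x y z ⟩
    ((x ⁻¹ ∙ y) ∙ Δ₂ G σ y) ∙ z                    ≈⟨ ∙-insert G ((x ⁻¹ ∙ y) ∙ Δ₂ G σ y) y z ⟨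
    (((x ⁻¹ ∙ y) ∙ Δ₂ G σ y) ∙ y) ∙ (y ⁻¹ ∙ z)     ≈⟨ ∙-congʳ (assoc (x ⁻¹ ∙ y) (Δ₂ G σ y) y) ⟩
    ((x ⁻¹ ∙ y) ∙ Δ₃ G σ y) ∙ (y ⁻¹ ∙ z)           ∎

  colour-changes-along-s100 : ∀ g x y z → col (g ∙ x , ε ∙ y , ε ∙ z) ≈ col (x , y , z) → g ≈ ε
  colour-changes-along-s100 g x y z eq = f[g∙u]≈f[u]⇒g≈ε G ⁻¹-injective g x
    (∙-cancelʳ (σ₀ y) ((g ∙ x) ⁻¹) (x ⁻¹) (∙-cancelʳ z ((g ∙ x) ⁻¹ ∙ σ₀ y) (x ⁻¹ ∙ σ₀ y) (begin
      ((g ∙ x) ⁻¹ ∙ σ₀ y) ∙ z       ≈⟨ colour-cong (refl , identityˡ y , identityˡ z) ⟨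
      col (g ∙ x , ε ∙ y , ε ∙ z)   ≈⟨ eq ⟩
      (x ⁻¹ ∙ σ₀ y) ∙ z             ∎)))

  colour-changes-along-s010 : Injective _≈_ _≈_ σ₀ →
    ∀ g x y z → col (ε ∙ x , g ∙ y , ε ∙ z) ≈ col (x , y , z) → g ≈ ε
  colour-changes-along-s010 σ-injective g x y z eq = f[g∙u]≈f[u]⇒g≈ε G σ-injective g y
    (∙-cancel-frame G (x ⁻¹) z (begin
      (x ⁻¹ ∙ σ₀ (g ∙ y)) ∙ z       ≈⟨ colour-cong (identityˡ x , refl , identityˡ z) ⟨
      col (ε ∙ x , g ∙ y , ε ∙ z)   ≈⟨ eq ⟩
      (x ⁻¹ ∙ σ₀ y) ∙ z             ∎))

  colour-changes-along-s001 : ∀ g x y z → col (ε ∙ x , ε ∙ y , g ∙ z) ≈ col (x , y , z) → g ≈ ε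
  colour-changes-along-s001 g x y z eq = identityˡ-unique g z
    (∙-cancelˡ (x ⁻¹ ∙ σ₀ y) (g ∙ z) z (begin
      (x ⁻¹ ∙ σ₀ y) ∙ (g ∙ z)       ≈⟨ colour-cong (identityˡ x , identityˡ y , refl) ⟨
      col (ε ∙ x , ε ∙ y , g ∙ z)   ≈⟨ eq ⟩
      (x ⁻¹ ∙ σ₀ y) ∙ z             ∎))

  colour-changes-along-s110 : Injective _≈_ _≈_ (Δ₂ G σ) →
    ∀ g x y z → col (g ∙ x , g ∙ y , ε ∙ z) ≈ col (x , y , z) → g ≈ ε
  colour-changes-along-s110 Δ₂-injective g x y z eq = f[g∙u]≈f[u]⇒g≈ε G Δ₂-injective g y
    (∙-cancel-frame G (x ⁻¹ ∙ y) z (begin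
      ((x ⁻¹ ∙ y) ∙ Δ₂ G σ (g ∙ y)) ∙ z                 ≈⟨ ∙-congʳ (∙-congʳ (⁻¹∙-invariant G g x y)) ⟨
      (((g ∙ x) ⁻¹ ∙ (g ∙ y)) ∙ Δ₂ G σ (g ∙ y)) ∙ z     ≈⟨ colour-via-Δ₂ (g ∙ x) (g ∙ y) z ⟨
      col (g ∙ x , g ∙ y , z)                           ≈⟨ colour-cong (refl , refl , identityˡ z) ⟨
      col (g ∙ x , g ∙ y , ε ∙ z)                       ≈⟨ eq ⟩
      col (x , y , z)                                   ≈⟨ colour-via-Δ₂ x y z ⟩
      ((x ⁻¹ ∙ y) ∙ Δ₂ G σ y) ∙ z                       ∎))

  colour-changes-along-s011 : Injective _≈_ _≈_ (Δ₁ G σ) →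
    ∀ g x y z → col (ε ∙ x , g ∙ y , g ∙ z) ≈ col (x , y , z) → g ≈ ε
  colour-changes-along-s011 Δ₁-injective g x y z eq = f[g∙u]≈f[u]⇒g≈ε G Δ₁-injective g y
    (∙-cancel-frame G (x ⁻¹) (y ⁻¹ ∙ z) (begin
      (x ⁻¹ ∙ Δ₁ G σ (g ∙ y)) ∙ (y ⁻¹ ∙ z)               ≈⟨ ∙-congˡ (⁻¹∙-invariant G g y z) ⟨
      (x ⁻¹ ∙ Δ₁ G σ (g ∙ y)) ∙ ((g ∙ y) ⁻¹ ∙ (g ∙ z))   ≈⟨ colour-via-Δ₁ x (g ∙ y) (g ∙ z) ⟨
      col (x , g ∙ y , g ∙ z)                            ≈⟨ colour-cong (identityˡ x , refl , refl) ⟨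
      col (ε ∙ x , g ∙ y , g ∙ z)                        ≈⟨ eq ⟩
      col (x , y , z)                                    ≈⟨ colour-via-Δ₁ x y z ⟩
      (x ⁻¹ ∙ Δ₁ G σ y) ∙ (y ⁻¹ ∙ z)                     ∎))

  colour-changes-along-s111 : Injective _≈_ _≈_ (Δ₃ G σ) →
    ∀ g x y z → col (g ∙ x , g ∙ y , g ∙ z) ≈ col (x , y , z) → g ≈ ε
  colour-changes-along-s111 Δ₃-injective g x y z eq = f[g∙u]≈f[u]⇒g≈ε G Δ₃-injective g y
    (∙-cancel-frame G (x ⁻¹ ∙ y) (y ⁻¹ ∙ z) (begin
      ((x ⁻¹ ∙ y) ∙ Δ₃ G σ (g ∙ y)) ∙ (y ⁻¹ ∙ z)                   ≈⟨ translated ⟨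
      (((g ∙ x) ⁻¹ ∙ (g ∙ y)) ∙ Δ₃ G σ (g ∙ y)) ∙ ((g ∙ y) ⁻¹ ∙ (g ∙ z))
                                                                   ≈⟨ colour-via-Δ₃ (g ∙ x) (g ∙ y) (g ∙ z) ⟨
      col (g ∙ x , g ∙ y , g ∙ z)                                  ≈⟨ eq ⟩
      col (x , y , z)                                              ≈⟨ colour-via-Δ₃ x y z ⟩
      ((x ⁻¹ ∙ y) ∙ Δ₃ G σ y) ∙ (y ⁻¹ ∙ z)                         ∎))
    where
    translated : ((g ∙ x) ⁻¹ ∙ (g ∙ y)) ∙ Δ₃ G σ (g ∙ y) ∙ ((g ∙ y) ⁻¹ ∙ (g ∙ z))
               ≈ ((x ⁻¹ ∙ y) ∙ Δ₃ G σ (g ∙ y)) ∙ (y ⁻¹ ∙ z)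
    translated = ∙-cong (∙-congʳ (⁻¹∙-invariant G g x y)) (⁻¹∙-invariant G g y z)

  module _ (σ-injective : Injective _≈_ _≈_ σ₀)
           (Δ₁-injective : Injective _≈_ _≈_ (Δ₁ G σ))
           (Δ₂-injective : Injective _≈_ _≈_ (Δ₂ G σ))
           (Δ₃-injective : Injective _≈_ _≈_ (Δ₃ G σ)) where

    S₃-changes-colour : ∀ {s} → S₃ G s → ∀ v → ¬ col (_·_ G s v) ≈ col v
    S₃-changes-colour (s100 g g≉ε) (x , y , z) eq = g≉ε (colour-changes-along-s100 g x y z eq)
    S₃-changes-colour (s010 g g≉ε) (x , y , z) eq = g≉ε (colour-changes-along-s010 σ-injective g x y z eq)
    S₃-changes-colour (s001 g g≉ε) (x , y , z) eq = g≉ε (colour-changes-along-s001 g x y z eq)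
    S₃-changes-colour (s110 g g≉ε) (x , y , z) eq = g≉ε (colour-changes-along-s110 Δ₂-injective g x y z eq)
    S₃-changes-colour (s011 g g≉ε) (x , y , z) eq = g≉ε (colour-changes-along-s011 Δ₁-injective g x y z eq)
    S₃-changes-colour (s111 g g≉ε) (x , y , z) eq = g≉ε (colour-changes-along-s111 Δ₃-injective g x y z eq)

    colour-proper : IsProperColouring G col
    colour-proper v w (s , s∈S₃ , w≈s·v) cv≈cw =
      S₃-changes-colour s∈S₃ v (trans (sym (colour-cong w≈s·v)) (sym cv≈cw))

proposition1p1 : (G : Group 0ℓ 0ℓ) → IsFinite G → (σ : Map G) →
    IsColouringBijection G σ → IsProperColouring G (colour G σ)
proposition1p1 G _ σ ((_ , σ-inj , _) , (_ , Δ₁-inj , _) , (_ , Δ₂-inj , _) , (_ , Δ₃-inj , _)) =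
  colour-proper G σ σ-inj Δ₁-inj Δ₂-inj Δ₃-inj
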